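{- Let $G=(V,E,\chi)$ and $G'=(V',E',\chi')$ be vertex-coloured graphs with $|V|=|V'|$, and let $f$ be a flip function for $G$ and $G'$. Let $(\bar v,\bar w)=((v_1,\dots,v_k),(w_1,\dots,w_k))$ be a position in the bijective $k$-pebble game $\mathrm{BP}_k(G,G')$. Then Spoiler wins from $(\bar v,\bar w)$ in $\mathrm{BP}_k(G,G')$ if and only if Spoiler wins from $(\bar v,\bar w)$ in $\mathrm{BP}_k(G^f,(G')^f)$.
   Context: A flip function for coloured graphs whose colours lie in a set $\mathcal C$ is a map $f:\mathcal C\times\mathcal C\to\{0,1\}$ with $f(c,c')=f(c',c)$. The flipped graph $G^f=(V,E^f,\chi)$ has $E^f=\{vw\in E\mid f(\chi(v),\chi(w))=0\}\cup\{vw\mid v\ne w, vw\notin E, f(\chi(v),\chi(w))=1\}$. The bijective $k$-pebble game $\mathrm{BP}_k(G,H)$ on coloured graphs with equally many vertices: positions are pairs $(\bar v,\bar w)$ of tuples of equal length $\ell\le k$, starting from $((),())$. In each round Spoiler either removes the $i$-th entry from both tuples (if $\ell>0$), or (if $\ell<k$) Duplicator picks a bijection $h:V(G)\to V(H)$, Spoiler picks $v\in V(G)$, and the position becomes $((\bar v,v),(\bar w,h(v)))$. Spoiler wins when the current position is not a partial isomorphism, i.e., some $\chi_G(v_i)\ne\chi_H(w_i)$, or for some $i,j$: $v_i=v_j\not\Leftrightarrow w_i=w_j$ or $v_iv_j\in E(G)\not\Leftrightarrow w_iw_j\in E(H)$; Duplicator wins infinite plays. Spoiler wins from a position if he has a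 strategy from it that wins against all Duplicator moves. -}

module Defs where

open import Data.Nat using (ℕ; suc; _<_)
open import Data.Fin using (Fin; _≟_)
open import Data.Bool using (Bool; true; false; _∧_; _∨_; not)
open import Data.Vec using (Vec; lookup; removeAt; _∷ʳ_)
open import Data.Product using (_×_; ∃-syntax)
open import Relation.Binary.PropositionalEquality using (_≡_)
open import Relation.Nullary using (¬_)
open import Relation.Nullary.Decidable using (⌊_⌋)
open import Function.Bundles using (_⤖_; Bijection; _⇔_)

record Graph (C : Set) (n : ℕ) : Set where
  field
    adj    : Fin n → Fin n → Bool
    adj-sym : ∀ v w → adj v w ≡ adj w v
    adj-irr : ∀ v → adj v v ≡ false
    col    : Fin n → C
open Graph public

-- A flip function f : C × C → {0,1}, symmetric; {0,1} is Bool with 0 = false, 1 = true.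
record FlipFunction (C : Set) : Set where
  field
    fun : C → C → Bool
    fun-sym : ∀ c c' → fun c c' ≡ fun c' c
open FlipFunction public

flipAdj : ∀ {C n} → Graph C n → FlipFunction C → Fin n → Fin n → Bool
flipAdj G f v w =
  (adj G v w ∧ not (fun f (col G v) (col G w)))
  ∨ (not ⌊ v ≟ w ⌋ ∧ not (adj G v w) ∧ fun f (col G v) (col G w))

flipGraph : ∀ {C n} → Graph C n → FlipFunction C → Graph C n
flipGraph {C} {n} G f = record
  { adj = flipAdj G f
  ; adj-sym = sym'
  ; adj-irr = irr'
  ; col = col G
  }
  where
  open import Relation.Binary.PropositionalEquality using (refl; cong₂; trans; sym)
  open import Relation.Nullary using (yes; no)
  sym' : ∀ v w → flipAdj G f v w ≡ flipAdj G f w v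
  sym' v w with v ≟ w | w ≟ v
  ... | yes refl | yes _ = refl
  ... | yes refl | no ne with () ← ne refl
  ... | no ne | yes refl with () ← ne refl
  ... | no _ | no _ rewrite adj-sym G v w | fun-sym f (col G v) (col G w) = refl
  irr' : ∀ v → flipAdj G f v v ≡ false
  irr' v with v ≟ v
  ... | yes _ rewrite adj-irr G v = refl
  ... | no ne with () ← ne refl

PartialIso : ∀ {C n ℓ} → Graph C n → Graph C n → Vec (Fin n) ℓ → Vec (Fin n) ℓ → Set
PartialIso {ℓ = ℓ} G H vs ws =
  (∀ (i : Fin ℓ) → col G (lookup vs i) ≡ col H (lookup ws i))
  × (∀ (i j : Fin ℓ) → (lookup vs i ≡ lookup vs j) ⇔ (lookup ws i ≡ lookup ws j))
  × (∀ (i j : Fin ℓ) → (adj G (lookup vs i) (lookup vs j) ≡ true)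
                        ⇔ (adj H (lookup ws i) (lookup ws j) ≡ true))

-- Spoiler wins BP_k(G,H) from position (v̄,w̄): the least set of positions closed
-- under the rules (a winning strategy for Spoiler = well-founded game tree):
--  * the position is not a partial isomorphism (Spoiler has won), or
--  * Spoiler removes the i-th pebble pair and wins from the result, or
--  * ℓ < k and for every bijection h chosen by Duplicator, Spoiler can pick v
--    such that he wins from ((v̄,v),(w̄,h(v))).
data SpoilerWins {C : Set} {n : ℕ} (k : ℕ) (G H : Graph C n)
     : ∀ {ℓ} → Vec (Fin n) ℓ → Vec (Fin n) ℓ → Set where
  won    : ∀ {ℓ} {vs ws : Vec (Fin n) ℓ} →
           ¬ PartialIso G H vs ws → SpoilerWins k G H vs ws
  remove : ∀ {ℓ} {vs ws : Vec (Fin n) (suc ℓ)} (i : Fin (suc ℓ)) →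
           SpoilerWins k G H (removeAt vs i) (removeAt ws i) →
           SpoilerWins k G H vs ws
  pebble : ∀ {ℓ} {vs ws : Vec (Fin n) ℓ} → ℓ < k →
           ((h : Fin n ⤖ Fin n) →
             ∃[ x ] SpoilerWins k G H (vs ∷ʳ x) (ws ∷ʳ Bijection.to h x)) →
           SpoilerWins k G H vs ws

-- Off the diagonal, the flipped adjacency is the original adjacency xor-ed
-- with the bit f(χv,χw); on the diagonal both graphs have no loops.  So if two
-- pebbled pairs (v,w) in G and (v',w') in H have the same equality type and
-- matching colours, then f contributes the SAME bit on both sides, and since
-- xor with a fixed bit is injective, v,w are adjacent in G exactly as v',w'
-- are in H iff the same holds in the flipped graphs.  Hence a position is a
-- partial isomorphism between G and H iff it is one between G^f and H^f.
-- Finally, SpoilerWins only consults the two graphs through PartialIso (the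
-- moves do not depend on edges), so any implication between partial-iso
-- predicates transfers winning strategies by structural recursion.  The
-- theorem is these two facts combined in both directions.
module Submission where

open import Defs
open import Data.Nat using (ℕ; _≤_)
open import Data.Fin using (Fin; _≟_)
open import Data.Vec using (Vec; lookup)
open import Data.Bool using (Bool; true; false; _xor_)
open import Data.Bool.Properties using (not-¬)
open import Data.Product using (_,_; proj₁; proj₂)
open import Function using (const)
open import Function.Bundles using (_⇔_; mk⇔; Equivalence)
open import Relation.Binary.PropositionalEquality
  using (_≡_; _≢_; refl; sym; trans; cong)
open import Relation.Nullary using (Dec; yes; no; contradiction)

≡true-⇔⇒≡ : ∀ {b b' : Bool} → (b ≡ true ⇔ b' ≡ true) → b ≡ b'
≡true-⇔⇒≡ {false} {false} _ = refl
≡true-⇔⇒≡ {false} {true}  e = Equivalence.from e refl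
≡true-⇔⇒≡ {true}  {false} e = sym (Equivalence.to e refl)
≡true-⇔⇒≡ {true}  {true}  _ = refl

≡⇒≡true-⇔ : ∀ {b b' : Bool} → b ≡ b' → (b ≡ true ⇔ b' ≡ true)
≡⇒≡true-⇔ refl = mk⇔ (λ p → p) (λ p → p)

xor-cancelʳ : ∀ x y c → x xor c ≡ y xor c → x ≡ y
xor-cancelʳ false false c _ = refl
xor-cancelʳ false true  c e = contradiction e (not-¬ refl)
xor-cancelʳ true  false c e = contradiction (sym e) (not-¬ refl)
xor-cancelʳ true  true  c _ = refl

xor-cancelʳ-⇔ : ∀ x y c → x ≡ y ⇔ x xor c ≡ y xor c
xor-cancelʳ-⇔ x y c = mk⇔ (cong (_xor c)) (xor-cancelʳ x y c)

module _ {C : Set} {n : ℕ} (f : FlipFunction C) where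

  flipAdj-≢ : (G : Graph C n) {v w : Fin n} → v ≢ w →
              flipAdj G f v w ≡ adj G v w xor fun f (col G v) (col G w)
  flipAdj-≢ G {v} {w} v≢w with v ≟ w
  ... | yes v≡w = contradiction v≡w v≢w
  ... | no _ with adj G v w | fun f (col G v) (col G w)
  ...   | true  | true  = refl
  ...   | true  | false = refl
  ...   | false | c     = refl

  flipAdj-agrees : (G H : Graph C n) {v w v' w' : Fin n} →
    (v ≡ w ⇔ v' ≡ w') → col G v ≡ col H v' → col G w ≡ col H w' →
    adj G v w ≡ adj H v' w' ⇔ flipAdj G f v w ≡ flipAdj H f v' w'
  flipAdj-agrees G H {v} {w} {v'} {w'} sameEq cv cw = byCases (v ≟ w)
    where
    -- Case split on v ≟ w without abstracting it out of the goal.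
    byCases : Dec (v ≡ w) → adj G v w ≡ adj H v' w' ⇔ flipAdj G f v w ≡ flipAdj H f v' w'
    byCases (yes refl) with Equivalence.to sameEq refl
    ... | refl = mk⇔
      (const (trans (adj-irr (flipGraph G f) v) (sym (adj-irr (flipGraph H f) v'))))
      (const (trans (adj-irr G v) (sym (adj-irr H v'))))
    byCases (no v≢w)
      rewrite flipAdj-≢ G v≢w
            | flipAdj-≢ H (λ v'≡w' → v≢w (Equivalence.from sameEq v'≡w'))
            | cv | cw
      = xor-cancelʳ-⇔ (adj G v w) (adj H v' w') (fun f (col H v') (col H w'))

  partialIso-flip : (G H : Graph C n) {ℓ : ℕ} (vs ws : Vec (Fin n) ℓ) →
    PartialIso G H vs ws ⇔ PartialIso (flipGraph G f) (flipGraph H f) vs ws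
  partialIso-flip G H vs ws = mk⇔
    (λ (c , e , a) → c , e , λ i j → ≡⇒≡true-⇔
       (Equivalence.to   (agrees c e i j) (≡true-⇔⇒≡ (a i j))))
    (λ (c , e , a) → c , e , λ i j → ≡⇒≡true-⇔
       (Equivalence.from (agrees c e i j) (≡true-⇔⇒≡ (a i j))))
    where
    agrees : (∀ i → col G (lookup vs i) ≡ col H (lookup ws i)) →
             (∀ i j → (lookup vs i ≡ lookup vs j) ⇔ (lookup ws i ≡ lookup ws j)) →
             ∀ i j → adj G (lookup vs i) (lookup vs j) ≡ adj H (lookup ws i) (lookup ws j)
                   ⇔ flipAdj G f (lookup vs i) (lookup vs j) ≡ flipAdj H f (lookup ws i) (lookup ws j)
    agrees c e i j = flipAdj-agrees G H (e i j) (c i) (c j)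

-- Spoiler's winning strategies only depend on the graphs through PartialIso:
-- if every partial isomorphism of A', B' is one of A, B, then whatever Spoiler
-- wins in BP_k(A,B) he also wins in BP_k(A',B').
spoilerWins-transfer : ∀ {C : Set} {n k : ℕ} {A B A' B' : Graph C n} →
  (∀ {ℓ} (vs ws : Vec (Fin n) ℓ) → PartialIso A' B' vs ws → PartialIso A B vs ws) →
  ∀ {ℓ} {vs ws : Vec (Fin n) ℓ} → SpoilerWins k A B vs ws → SpoilerWins k A' B' vs ws
spoilerWins-transfer T {vs = vs} {ws} (won notIso) = won (λ iso → notIso (T vs ws iso))
spoilerWins-transfer T (remove i wins) = remove i (spoilerWins-transfer T wins)
spoilerWins-transfer T (pebble ℓ<k strategy) = pebble ℓ<k λ h →
  proj₁ (strategy h) , spoilerWins-transfer T (proj₂ (strategy h))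

lemma3p8 : {C : Set} (n k : ℕ) (G G' : Graph C n) (f : FlipFunction C)
    (ℓ : ℕ) → ℓ ≤ k → (vs ws : Vec (Fin n) ℓ) →
    SpoilerWins k G G' vs ws ⇔ SpoilerWins k (flipGraph G f) (flipGraph G' f) vs ws
lemma3p8 n k G G' f ℓ _ vs ws = mk⇔
  (spoilerWins-transfer λ vs ws → Equivalence.from (partialIso-flip f G G' vs ws))
  (spoilerWins-transfer λ vs ws → Equivalence.to   (partialIso-flip f G G' vs ws))
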